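{- Every distance critical graph on $n$ vertices has at least $n$ edges, and for every $n \ge 5$ the cycle $C_n$ is a distance critical graph on $n$ vertices with exactly $n$ edges.
   Context: All graphs are finite, simple and undirected. For vertices $x,y$ of a graph $G$, $d_G(x,y)$ is the length of a shortest path from $x$ to $y$ in $G$ ($\infty$ if none exists). A graph $G$ is distance critical if for every vertex $v \in V(G)$ there exist vertices $x,y \in V(G)\setminus\{v\}$ with $d_G(x,y) \neq d_{G-v}(x,y)$. -}

module Defs where

open import Data.Nat using (ℕ; zero; suc; _<_; _≡ᵇ_; _+_)
open import Data.Empty using (⊥)
open import Data.Bool using (Bool; true; false; _∧_; _∨_; T; if_then_else_)
open import Data.Bool.Properties using (∨-comm)
open import Data.Fin using (Fin; toℕ; punchIn; _<?_)
open import Data.Nat.ListAction using (sum)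
open import Data.List using (List; map; cartesianProduct; allFin)
open import Data.Maybe using (Maybe; just; nothing)
open import Data.Product using (_×_; _,_; ∃-syntax)
open import Relation.Nullary using (¬_; does)
open import Relation.Binary.PropositionalEquality using (_≡_; _≢_; refl)

record Graph (n : ℕ) : Set where
  field
    adj    : Fin n → Fin n → Bool
    sym    : ∀ i j → adj i j ≡ adj j i
    irrefl : ∀ i → adj i i ≡ false
open Graph public

edgeCount : ∀ {n} → Graph n → ℕ
edgeCount {n} G =
  sum (map (λ p → count p) (cartesianProduct (allFin n) (allFin n)))
  where
  count : Fin n × Fin n → ℕ
  count (i , j) = if adj G i j ∧ does (i <? j) then 1 else 0

data Walk {n : ℕ} (G : Graph n) : Fin n → Fin n → ℕ → Set where
  here : ∀ {x} → Walk G x x 0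
  step : ∀ {x y z k} → T (adj G x y) → Walk G y z k → Walk G x z (suc k)

-- d_G(x,y) = d, where nothing stands for ∞.
IsDist : ∀ {n} → Graph n → Fin n → Fin n → Maybe ℕ → Set
IsDist G x y (just k) = Walk G x y k × (∀ j → j < k → ¬ Walk G x y j)
IsDist G x y nothing  = ∀ k → ¬ Walk G x y k

-- G - v : delete vertex v; vertices of G - v are Fin m, where
-- x : Fin m corresponds to the vertex punchIn v x ≠ v of G.
deleteVertex : ∀ {m} → Graph (suc m) → Fin (suc m) → Graph m
deleteVertex G v = record
  { adj    = λ i j → adj G (punchIn v i) (punchIn v j)
  ; sym    = λ i j → sym G (punchIn v i) (punchIn v j)
  ; irrefl = λ i → irrefl G (punchIn v i)
  }

DistanceCritical : ∀ {n} → Graph n → Set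
DistanceCritical {zero}  G = ∀ (v : Fin zero) → ⊥
DistanceCritical {suc m} G =
  ∀ (v : Fin (suc m)) → ∃[ x ] ∃[ y ] ∃[ d₁ ] ∃[ d₂ ]
    (IsDist G (punchIn v x) (punchIn v y) d₁ ×
     IsDist (deleteVertex G v) x y d₂ × d₁ ≢ d₂)

-- Cycle C_N on N = 3 + k vertices 0,1,…,N-1: i ~ i+1 and 0 ~ N-1.
private
  cycRel : ℕ → ℕ → ℕ → Bool
  cycRel k a b = (b ≡ᵇ suc a) ∨ ((a ≡ᵇ 0) ∧ (b ≡ᵇ suc (suc k)))

  noSuc : ∀ a → (a ≡ᵇ suc a) ≡ false
  noSuc zero = refl
  noSuc (suc a) = noSuc a

  cycIrr : ∀ k a → cycRel k a a ≡ false
  cycIrr k zero = refl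
  cycIrr k (suc a) rewrite noSuc a = refl

  orFalse : ∀ {b} → b ≡ false → (b ∨ b) ≡ false
  orFalse refl = refl

cycle : (k : ℕ) → Graph (3 + k)
cycle k = record
  { adj    = λ i j → cycRel k (toℕ i) (toℕ j) ∨ cycRel k (toℕ j) (toℕ i)
  ; sym    = λ i j → ∨-comm (cycRel k (toℕ i) (toℕ j)) (cycRel k (toℕ j) (toℕ i))
  ; irrefl = λ i → orFalse (cycIrr k (toℕ i))
  }

{-# OPTIONS --safe #-}
-- If deleting v changes the distance between x and y, then every shortest x–y walk in G
-- passes through v: a shortest walk avoiding v would survive in G - v, and G - v has no
-- walks that G lacks.  Such a walk enters and leaves v through two different neighbours
-- (else it could be shortened), so every vertex has degree at least 2 and the handshake
-- lemma gives 2|E| = Σ deg ≥ 2n.  In C_n with n ≥ 5 the two neighbours of v are at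
-- distance 2, but v is their only common neighbour, so their distance in C_n - v is
-- different.  Distances in G - v exist because a walk without repeated vertices is
-- shorter than the number of vertices, which makes reachability decidable.
module Submission where

open import Defs
open import Data.Bool using (Bool; true; false; _∧_; _∨_; T; if_then_else_)
open import Data.Bool.Properties using (T-∨; T-∧)
open import Data.Fin using (Fin; zero; suc; toℕ; fromℕ; fromℕ<; inject₁; punchIn; punchOut; _<?_)
import Data.Fin.Properties as Fin
open import Data.Fin.Properties
  using (_≟_; any?; injective⇒≤; toℕ<n; toℕ-injective; toℕ-fromℕ; toℕ-fromℕ<; toℕ-inject₁;
         punchIn-injective; punchInᵢ≢i; punchIn-punchOut)
open import Data.List using (_++_; map; tabulate; cartesianProduct)
open import Data.List.Properties using (map-++; map-tabulate)
import Data.Nat.ListAction as List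
open import Data.Nat.ListAction.Properties using (sum-++)
open import Data.Maybe using (just; nothing)
open import Data.Nat using (ℕ; zero; suc; _+_; _*_; _≤_; _<_; z≤n; s≤s; s≤s⁻¹; z<s; _≡ᵇ_)
open import Data.Nat.Properties
  using (+-0-commutativeMonoid; +-identityʳ; +-suc; *-comm; +-mono-≤; +-monoʳ-≤; +-monoˡ-<;
         m≤m+n; m<m+n; m<1+n⇒m<n∨m≡n; ≤∧≢⇒<; <-cmp; <-irrefl; *-cancelˡ-≤; *-cancelˡ-≡;
         ≡ᵇ⇒≡; ≡⇒≡ᵇ; module ≤-Reasoning)
  renaming (_≟_ to _≟ℕ_)
open import Algebra.Properties.CommutativeMonoid.Sum +-0-commutativeMonoid
  using (sum; sum-syntax; sum-cong-≗; sum-remove; sum-replicate-zero; ∑-distrib-+; ∑-comm)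
open import Data.Product using (_×_; _,_; proj₁; proj₂; Σ-syntax; ∃-syntax)
open import Data.Sum using (_⊎_; inj₁; inj₂; [_,_])
open import Data.Vec using (Vec; []; _∷_)
open import Data.Vec.Membership.Propositional using (_∈_; _∉_)
open import Data.Vec.Relation.Unary.All using (All; []; _∷_)
open import Data.Vec.Relation.Unary.Any as Any using (here; there)
open import Data.Vec.Relation.Unary.Unique.Propositional using (Unique; []; _∷_)
open import Data.Vec.Relation.Unary.Unique.Propositional.Properties using (lookup-injective)
open import Function using (_∘_)
open import Function.Bundles using (Equivalence)
open import Relation.Binary.Definitions using (tri<; tri≈; tri>)
open import Relation.Binary.PropositionalEquality
  using (_≡_; _≢_; refl; cong; cong₂; subst; subst₂; trans; module ≡-Reasoning)
  renaming (sym to ≡-sym)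
open import Relation.Nullary using (¬_; Dec; yes; no; does; contradiction)
open import Relation.Nullary.Decidable using (dec-true; dec-false; T?; _×-dec_)
open import Relation.Unary using (Decidable)

open Equivalence using (to; from)

-- Finite sums

sum-tabulate : ∀ {n} (f : Fin n → ℕ) → List.sum (tabulate f) ≡ sum f
sum-tabulate {zero}  f = refl
sum-tabulate {suc n} f = cong (f zero +_) (sum-tabulate (f ∘ suc))

sum-cartesianProduct-tabulate :
  ∀ {A B : Set} {m n} (f : A × B → ℕ) (g : Fin m → A) (h : Fin n → B) →
  List.sum (map f (cartesianProduct (tabulate g) (tabulate h))) ≡
  ∑[ i < m ] ∑[ j < n ] f (g i , h j)
sum-cartesianProduct-tabulate {m = zero}  f g h = refl
sum-cartesianProduct-tabulate {m = suc m} {n} f g h = begin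
  List.sum (map f (map (g zero ,_) (tabulate h) ++ rest))
    ≡⟨ cong List.sum (map-++ f (map (g zero ,_) (tabulate h)) rest) ⟩
  List.sum (map f (map (g zero ,_) (tabulate h)) ++ map f rest)
    ≡⟨ sum-++ (map f (map (g zero ,_) (tabulate h))) (map f rest) ⟩
  List.sum (map f (map (g zero ,_) (tabulate h))) + List.sum (map f rest)
    ≡⟨ cong₂ _+_ first-row (sum-cartesianProduct-tabulate f (g ∘ suc) h) ⟩
  ∑[ j < n ] f (g zero , h j) + ∑[ i < m ] ∑[ j < n ] f (g (suc i) , h j) ∎
  where
  open ≡-Reasoning
  rest = cartesianProduct (tabulate (g ∘ suc)) (tabulate h)
  first-row : List.sum (map f (map (g zero ,_) (tabulate h))) ≡ ∑[ j < n ] f (g zero , h j)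
  first-row = begin
    List.sum (map f (map (g zero ,_) (tabulate h)))
      ≡⟨ cong (List.sum ∘ map f) (map-tabulate h (g zero ,_)) ⟩
    List.sum (map f (tabulate (λ j → g zero , h j)))
      ≡⟨ cong List.sum (map-tabulate (λ j → g zero , h j) f) ⟩
    List.sum (tabulate (λ j → f (g zero , h j)))
      ≡⟨ sum-tabulate (λ j → f (g zero , h j)) ⟩
    ∑[ j < n ] f (g zero , h j) ∎

sum-const : ∀ n c → ∑[ i < n ] c ≡ n * c
sum-const zero    c = refl
sum-const (suc n) c = cong (c +_) (sum-const n c)

sum-mono-≤ : ∀ {n} {f g : Fin n → ℕ} → (∀ i → f i ≤ g i) → sum f ≤ sum g
sum-mono-≤ {zero}  f≤g = z≤n
sum-mono-≤ {suc n} f≤g = +-mono-≤ (f≤g zero) (sum-mono-≤ (f≤g ∘ suc))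

element≤sum : ∀ {n} (f : Fin n → ℕ) i → f i ≤ sum f
element≤sum {suc n} f i = subst (f i ≤_) (≡-sym (sum-remove {i = i} f)) (m≤m+n (f i) _)

pair≤sum : ∀ {n} (f : Fin n → ℕ) {a b} → a ≢ b → f a + f b ≤ sum f
pair≤sum {suc n} f {a} {b} a≢b = begin
  f a + f b                          ≡⟨ cong (λ c → f a + f c) (punchIn-punchOut a≢b) ⟨
  f a + f (punchIn a (punchOut a≢b)) ≤⟨ +-monoʳ-≤ (f a) (element≤sum (f ∘ punchIn a) _) ⟩
  f a + sum (f ∘ punchIn a)          ≡⟨ sum-remove f ⟨
  sum f                              ∎
  where open ≤-Reasoning

sum-single : ∀ {n} (f : Fin n → ℕ) {a} → (∀ j → j ≢ a → f j ≡ 0) → sum f ≡ f a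
sum-single {suc n} f {a} vanish = begin
  sum f                            ≡⟨ sum-remove f ⟩
  f a + sum (f ∘ punchIn a)        ≡⟨ cong (f a +_) (sum-cong-≗ (λ j → vanish _ (punchInᵢ≢i a j))) ⟩
  f a + ∑[ j < n ] 0               ≡⟨ cong (f a +_) (sum-replicate-zero n) ⟩
  f a + 0                          ≡⟨ +-identityʳ (f a) ⟩
  f a                              ∎
  where open ≡-Reasoning

sum-pair : ∀ {n} (f : Fin n → ℕ) {a b} → a ≢ b → (∀ j → j ≢ a → j ≢ b → f j ≡ 0) → sum f ≡ f a + f b
sum-pair {suc n} f {a} {b} a≢b vanish = begin
  sum f                              ≡⟨ sum-remove f ⟩
  f a + sum (f ∘ punchIn a)          ≡⟨ cong (f a +_) (sum-single (f ∘ punchIn a) vanish′) ⟩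
  f a + f (punchIn a (punchOut a≢b)) ≡⟨ cong (λ c → f a + f c) (punchIn-punchOut a≢b) ⟩
  f a + f b                          ∎
  where
  open ≡-Reasoning
  vanish′ : ∀ j → j ≢ punchOut a≢b → f (punchIn a j) ≡ 0
  vanish′ j j≢b = vanish _ (punchInᵢ≢i a j)
    (λ eq → j≢b (punchIn-injective a _ _ (trans eq (≡-sym (punchIn-punchOut a≢b)))))

-- Degrees and the handshake lemma

indicator : Bool → ℕ
indicator b = if b then 1 else 0

T⇒indicator≡1 : ∀ {b} → T b → indicator b ≡ 1
T⇒indicator≡1 {true} _ = refl

exactly-one-< : ∀ {n} {i j : Fin n} → i ≢ j →
                indicator (does (i <? j)) + indicator (does (j <? i)) ≡ 1
exactly-one-< {i = i} {j} i≢j with Fin.<-cmp i j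
... | tri< i<j _ j≮i =
  cong₂ (λ b c → indicator b + indicator c) (dec-true (i <? j) i<j) (dec-false (j <? i) j≮i)
... | tri≈ _ i≡j _ = contradiction i≡j i≢j
... | tri> i≮j _ j<i =
  cong₂ (λ b c → indicator b + indicator c) (dec-false (i <? j) i≮j) (dec-true (j <? i) j<i)

degree : ∀ {n} → Graph n → Fin n → ℕ
degree {n} G i = ∑[ j < n ] indicator (adj G i j)

module _ {n : ℕ} (G : Graph n) where

  private
    oriented : Fin n → Fin n → ℕ
    oriented i j = indicator (adj G i j ∧ does (i <? j))

  edgeCount≡∑∑ : edgeCount G ≡ ∑[ i < n ] ∑[ j < n ] oriented i j
  edgeCount≡∑∑ = sum-cartesianProduct-tabulate (λ (i , j) → oriented i j) (λ i → i) (λ j → j)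

  oriented-both-ways : ∀ i j → oriented i j + oriented j i ≡ indicator (adj G i j)
  oriented-both-ways i j with i ≟ j
  ... | yes refl rewrite irrefl G i = refl
  ... | no i≢j rewrite sym G j i with adj G i j
  ...   | false = refl
  ...   | true  = exactly-one-< i≢j

  handshake : ∑[ i < n ] degree G i ≡ 2 * edgeCount G
  handshake = begin
    ∑[ i < n ] ∑[ j < n ] indicator (adj G i j)
      ≡⟨ sum-cong-≗ (λ i → sum-cong-≗ (oriented-both-ways i)) ⟨
    ∑[ i < n ] ∑[ j < n ] (oriented i j + oriented j i)
      ≡⟨ sum-cong-≗ (λ i → ∑-distrib-+ (oriented i) (λ j → oriented j i)) ⟩
    ∑[ i < n ] (∑[ j < n ] oriented i j + ∑[ j < n ] oriented j i)
      ≡⟨ ∑-distrib-+ (λ i → ∑[ j < n ] oriented i j) (λ i → ∑[ j < n ] oriented j i) ⟩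
    ∑[ i < n ] ∑[ j < n ] oriented i j + ∑[ i < n ] ∑[ j < n ] oriented j i
      ≡⟨ cong (∑[ i < n ] ∑[ j < n ] oriented i j +_) (∑-comm (λ i j → oriented j i)) ⟩
    ∑[ i < n ] ∑[ j < n ] oriented i j + ∑[ j < n ] ∑[ i < n ] oriented j i
      ≡⟨ cong₂ _+_ edgeCount≡∑∑ edgeCount≡∑∑ ⟨
    edgeCount G + edgeCount G
      ≡⟨ cong (edgeCount G +_) (+-identityʳ (edgeCount G)) ⟨
    2 * edgeCount G ∎
    where open ≡-Reasoning

  adj-sym : ∀ {a b} → T (adj G a b) → T (adj G b a)
  adj-sym {a} {b} = subst T (sym G a b)

  TwoNeighbours : Fin n → Set
  TwoNeighbours v = ∃[ a ] ∃[ b ] (a ≢ b × T (adj G v a) × T (adj G v b))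

  twoNeighbours⇒2≤degree : ∀ {v} → TwoNeighbours v → 2 ≤ degree G v
  twoNeighbours⇒2≤degree {v} (a , b , a≢b , v~a , v~b) =
    subst (_≤ degree G v) (cong₂ _+_ (T⇒indicator≡1 v~a) (T⇒indicator≡1 v~b)) (pair≤sum _ a≢b)

-- Walks and distances

least : ∀ {p} {P : ℕ → Set p} → Decidable P → ∀ {k} → P k → ∃[ m ] (P m × (∀ j → j < m → ¬ P j))
least {P = P} P? {k} = search 0 k (λ _ ())
  where
  search : ∀ s r → (∀ j → j < s → ¬ P j) → P (s + r) → ∃[ m ] (P m × (∀ j → j < m → ¬ P j))
  search s r below p with P? s
  ... | yes ps = s , ps , below
  search s zero    below p | no ¬ps = contradiction (subst P (+-identityʳ s) p) ¬ps
  search s (suc r) below p | no ¬ps = search (suc s) r below′ (subst P (+-suc s r) p)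
    where
    below′ : ∀ j → j < suc s → ¬ P j
    below′ j j<1+s = [ below j , (λ { refl → ¬ps }) ] (m<1+n⇒m<n∨m≡n j<1+s)

∉⇒All≢ : ∀ {A : Set} {u : A} {m} {xs : Vec A m} → u ∉ xs → All (u ≢_) xs
∉⇒All≢ {xs = []}    _    = []
∉⇒All≢ {xs = _ ∷ _} u∉xs = (u∉xs ∘ here) ∷ ∉⇒All≢ (u∉xs ∘ there)

module _ {n : ℕ} {G : Graph n} where

  _++ᵂ_ : ∀ {x y z i j} → Walk G x y i → Walk G y z j → Walk G x z (i + j)
  here       ++ᵂ w′ = w′
  step e w   ++ᵂ w′ = step e (w ++ᵂ w′)

  walk? : ∀ x y k → Dec (Walk G x y k)
  walk? x y zero with x ≟ y
  ... | yes refl = yes here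
  ... | no x≢y   = no λ { here → x≢y refl }
  walk? x y (suc k) with any? (λ z → T? (adj G x z) ×-dec walk? z y k)
  ... | yes (z , e , w) = yes (step e w)
  ... | no ¬w           = no λ { (step e w) → ¬w (_ , e , w) }

  IsDist-unique : ∀ {x y d d′} → IsDist G x y d → IsDist G x y d′ → d ≡ d′
  IsDist-unique {d = nothing} {nothing} _         _           = refl
  IsDist-unique {d = nothing} {just k}  none      (w , _)     = contradiction w (none k)
  IsDist-unique {d = just k}  {nothing} (w , _)   none        = contradiction w (none k)
  IsDist-unique {d = just k}  {just k′} (w , min) (w′ , min′) with <-cmp k k′
  ... | tri< k<k′ _ _ = contradiction w (min′ k k<k′)
  ... | tri≈ _ k≡k′ _ = cong just k≡k′
  ... | tri> _ _ k′<k = contradiction w′ (min k′ k′<k)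

  vertices : ∀ {x y k} → Walk G x y k → Vec (Fin n) (suc k)
  vertices {x} here       = x ∷ []
  vertices {x} (step _ w) = x ∷ vertices w

  SimpleWalk : Fin n → Fin n → Set
  SimpleWalk x y = ∃[ k ] Σ[ w ∈ Walk G x y k ] Unique (vertices w)

  simpleWalk-length<n : ∀ {x y k} (w : Walk G x y k) → Unique (vertices w) → k < n
  simpleWalk-length<n w unique = injective⇒≤ (lookup-injective unique _ _)

  suffix : ∀ {u x y k} (w : Walk G x y k) → Unique (vertices w) → u ∈ vertices w → SimpleWalk u y
  suffix here       unique       (here refl) = _ , here , unique
  suffix (step e w) unique       (here refl) = _ , step e w , unique
  suffix (step e w) (_ ∷ unique) (there u∈w) = suffix w unique u∈w

  toSimpleWalk : ∀ {x y k} → Walk G x y k → SimpleWalk x y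
  toSimpleWalk here = 0 , here , [] ∷ []
  toSimpleWalk {x} (step e w) with toSimpleWalk w
  ... | k , p , unique with Any.any? (x ≟_) (vertices p)
  ...   | yes x∈p = suffix p unique x∈p
  ...   | no x∉p  = suc k , step e p , ∉⇒All≢ x∉p ∷ unique

  walk⇒walk<n : ∀ {x y k} → Walk G x y k → ∃[ j ] (j < n × Walk G x y j)
  walk⇒walk<n w with toSimpleWalk w
  ... | j , p , unique = j , simpleWalk-length<n p unique , p

  dist : ∀ x y → ∃[ d ] IsDist G x y d
  dist x y with any? (λ (i : Fin n) → walk? x y (toℕ i))
  ... | yes (_ , w) = let d , w′ , min = least (walk? x y) w in just d , w′ , min
  ... | no ¬w = nothing , unreachable
    where
    unreachable : ∀ k → ¬ Walk G x y k
    unreachable k w with walk⇒walk<n w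
    ... | j , j<n , w′ = ¬w (fromℕ< j<n , subst (Walk G x y) (≡-sym (toℕ-fromℕ< j<n)) w′)

-- Deleting a vertex

module _ {m : ℕ} (G : Graph (suc m)) (v : Fin (suc m)) where

  private
    G-v : Graph m
    G-v = deleteVertex G v

  liftWalk : ∀ {x y k} → Walk G-v x y k → Walk G (punchIn v x) (punchIn v y) k
  liftWalk here       = here
  liftWalk (step e w) = step e (liftWalk w)

  record Detour (x y : Fin (suc m)) (k : ℕ) : Set where
    constructor detour
    field
      {a b}  : Fin (suc m)
      {i j}  : ℕ
      to-a   : Walk G x a i
      a~v    : T (adj G a v)
      v~b    : T (adj G v b)
      from-b : Walk G b y j
      length : i + 2 + j ≡ k

  shortcut : ∀ {x y k} (p : Detour x y k) → Detour.a p ≡ Detour.b p → ∃[ j ] (j < k × Walk G x y j)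
  shortcut (detour {i = i} {j} to-a _ _ from-b refl) refl =
    i + j , +-monoˡ-< j (m<m+n i z<s) , to-a ++ᵂ from-b

  avoid-or-detour : ∀ {x y x′ y′ k} → Walk G x′ y′ k → punchIn v x ≡ x′ → punchIn v y ≡ y′ →
                    Walk G-v x y k ⊎ Detour x′ y′ k
  avoid-or-detour here px py with punchIn-injective v _ _ (trans px (≡-sym py))
  ... | refl = inj₁ here
  avoid-or-detour {x} {y} (step {y = z} e w) refl py with v ≟ z
  ... | yes refl = inj₂ (leave w py)
    where
    leave : ∀ {y′ k} → Walk G v y′ k → punchIn v y ≡ y′ → Detour (punchIn v x) y′ (suc k)
    leave here          py = contradiction py (punchInᵢ≢i v y)
    leave (step e′ w′) _   = detour here e e′ w′ refl
  ... | no v≢z with avoid-or-detour w (punchIn-punchOut v≢z) py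
  ...   | inj₁ w′ =
    inj₁ (step (subst (T ∘ adj G (punchIn v x)) (≡-sym (punchIn-punchOut v≢z)) e) w′)
  ...   | inj₂ (detour to-a a~v v~b from-b length) =
    inj₂ (detour (step e to-a) a~v v~b from-b (cong suc length))

  distanceChange⇒twoNeighbours : ∀ {x y d₁ d₂} → IsDist G (punchIn v x) (punchIn v y) d₁ →
                                 IsDist G-v x y d₂ → d₁ ≢ d₂ → TwoNeighbours G v
  distanceChange⇒twoNeighbours {d₁ = nothing} none dist₂ d₁≢d₂ =
    contradiction (IsDist-unique (λ k → none k ∘ liftWalk) dist₂) d₁≢d₂
  distanceChange⇒twoNeighbours {d₁ = just k} (w , min) dist₂ d₁≢d₂ with avoid-or-detour w refl refl
  ... | inj₁ w′ = contradiction (IsDist-unique (w′ , λ j j<k → min j j<k ∘ liftWalk) dist₂) d₁≢d₂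
  ... | inj₂ p@(detour {a} {b} _ a~v v~b _ _) with a ≟ b
  ...   | yes a≡b = let _ , j<k , w′ = shortcut p a≡b in contradiction w′ (min _ j<k)
  ...   | no a≢b  = a , b , a≢b , adj-sym G a~v , v~b

distanceCritical⇒n≤edgeCount : ∀ {n} (G : Graph n) → DistanceCritical G → n ≤ edgeCount G
distanceCritical⇒n≤edgeCount {zero}  G _        = z≤n
distanceCritical⇒n≤edgeCount {suc m} G critical = *-cancelˡ-≤ 2 (begin
  2 * suc m                 ≡⟨ *-comm 2 (suc m) ⟩
  suc m * 2                 ≡⟨ sum-const (suc m) 2 ⟨
  ∑[ v < suc m ] 2          ≤⟨ sum-mono-≤ 2≤degree ⟩
  ∑[ v < suc m ] degree G v ≡⟨ handshake G ⟩
  2 * edgeCount G           ∎)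
  where
  open ≤-Reasoning
  2≤degree : ∀ v → 2 ≤ degree G v
  2≤degree v with critical v
  ... | _ , _ , _ , _ , dist₁ , dist₂ , d₁≢d₂ =
    twoNeighbours⇒2≤degree G (distanceChange⇒twoNeighbours G v dist₁ dist₂ d₁≢d₂)

-- Cycles

module Cycle (k : ℕ) where

  -- b follows a around the cycle 0 → 1 → ⋯ → 2 + k → 0 (up (2 + k) also points at 3 + k,
  -- which is not a vertex).
  data Succ : ℕ → ℕ → Set where
    up   : ∀ a → Succ a (suc a)
    wrap : Succ (2 + k) 0

  Succ-irreflexive : ∀ {a} → ¬ Succ a a
  Succ-irreflexive ()

  Succ-asymmetric : ∀ {a b} → Succ a b → ¬ Succ b a
  Succ-asymmetric (up _) ()
  Succ-asymmetric wrap   ()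

  Succ-injective : ∀ {a a′ b} → Succ a b → Succ a′ b → a ≡ a′
  Succ-injective (up _) (up _) = refl
  Succ-injective wrap   wrap   = refl

  Succ-functional : ∀ {a b b′} → Succ a b → Succ a b′ → b < 3 + k → b′ < 3 + k → b ≡ b′
  Succ-functional (up _) (up _) _   _   = refl
  Succ-functional (up _) wrap   b<n _    = contradiction b<n (<-irrefl refl)
  Succ-functional wrap   (up _) _   b′<n = contradiction b′<n (<-irrefl refl)
  Succ-functional wrap   wrap   _   _   = refl

  -- The Boolean is the relation cycRel k a b of Defs (private there), unfolded.
  arc⇒Succ : ∀ a b → T ((b ≡ᵇ suc a) ∨ ((a ≡ᵇ 0) ∧ (b ≡ᵇ 2 + k))) → Succ a b ⊎ Succ b a
  arc⇒Succ a b arc with to T-∨ arc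
  ... | inj₁ b≡1+a = inj₁ (subst (Succ a) (≡-sym (≡ᵇ⇒≡ b (suc a) b≡1+a)) (up a))
  ... | inj₂ ends with to T-∧ ends
  ...   | a≡0 , b≡last =
    inj₂ (subst₂ Succ (≡-sym (≡ᵇ⇒≡ b (2 + k) b≡last)) (≡-sym (≡ᵇ⇒≡ a 0 a≡0)) wrap)

  adj⇒Succ : ∀ i j → T (adj (cycle k) i j) → Succ (toℕ i) (toℕ j) ⊎ Succ (toℕ j) (toℕ i)
  adj⇒Succ i j i~j with to T-∨ i~j
  ... | inj₁ arc = arc⇒Succ (toℕ i) (toℕ j) arc
  ... | inj₂ arc = [ inj₂ , inj₁ ] (arc⇒Succ (toℕ j) (toℕ i) arc)

  Succ⇒adj : ∀ i j → Succ (toℕ i) (toℕ j) → T (adj (cycle k) i j)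
  Succ⇒adj i j s = lemma (toℕ i) (toℕ j) s
    where
    lemma : ∀ a b → Succ a b → T (((b ≡ᵇ suc a) ∨ ((a ≡ᵇ 0) ∧ (b ≡ᵇ 2 + k))) ∨
                                  ((a ≡ᵇ suc b) ∨ ((b ≡ᵇ 0) ∧ (a ≡ᵇ 2 + k))))
    lemma a _ (up _) = from T-∨ (inj₁ (from T-∨ (inj₁ (≡⇒≡ᵇ a a refl))))
    lemma _ _ wrap   = ≡⇒≡ᵇ k k refl

  successor : ∀ (i : Fin (3 + k)) → ∃[ j ] Succ (toℕ i) (toℕ {3 + k} j)
  successor i with toℕ i ≟ℕ 2 + k
  ... | yes i≡last = zero , subst (λ a → Succ a 0) (≡-sym i≡last) wrap
  ... | no i≢last  = fromℕ< i+1<n , subst (Succ (toℕ i)) (≡-sym (toℕ-fromℕ< i+1<n)) (up (toℕ i))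
    where
    i+1<n : suc (toℕ i) < 3 + k
    i+1<n = s≤s (≤∧≢⇒< (s≤s⁻¹ (toℕ<n i)) i≢last)

  predecessor : ∀ (j : Fin (3 + k)) → ∃[ i ] Succ (toℕ {3 + k} i) (toℕ j)
  predecessor zero    = fromℕ (2 + k) , subst (λ a → Succ a 0) (≡-sym (toℕ-fromℕ (2 + k))) wrap
  predecessor (suc j) =
    inject₁ j , subst (λ a → Succ a (suc (toℕ j))) (≡-sym (toℕ-inject₁ j)) (up (toℕ j))

  degree-cycle : ∀ i → degree (cycle k) i ≡ 2
  degree-cycle i with successor i | predecessor i
  ... | a , i→a | b , b→i =
    trans (sum-pair _ a≢b non-neighbour) (cong₂ _+_ (T⇒indicator≡1 i~a) (T⇒indicator≡1 i~b))
    where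
    i~a = Succ⇒adj i a i→a
    i~b = adj-sym (cycle k) {b} {i} (Succ⇒adj b i b→i)
    a≢b : a ≢ b
    a≢b refl = Succ-asymmetric i→a b→i
    non-neighbour : ∀ j → j ≢ a → j ≢ b → indicator (adj (cycle k) i j) ≡ 0
    non-neighbour j j≢a j≢b with adj (cycle k) i j in i~j
    ... | false = refl
    ... | true with adj⇒Succ i j (subst T (≡-sym i~j) _)
    ...   | inj₁ i→j =
      contradiction (toℕ-injective (Succ-functional i→j i→a (toℕ<n j) (toℕ<n a))) j≢a
    ...   | inj₂ j→i = contradiction (toℕ-injective (Succ-injective j→i b→i)) j≢b

  edgeCount-cycle : edgeCount (cycle k) ≡ 3 + k
  edgeCount-cycle = *-cancelˡ-≡ _ _ 2 (begin
    2 * edgeCount (cycle k)                   ≡⟨ handshake (cycle k) ⟨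
    ∑[ i < 3 + k ] degree (cycle k) i         ≡⟨ sum-cong-≗ degree-cycle ⟩
    ∑[ i < 3 + k ] 2                          ≡⟨ sum-const (3 + k) 2 ⟩
    (3 + k) * 2                               ≡⟨ *-comm (3 + k) 2 ⟩
    2 * (3 + k)                               ∎)
    where open ≡-Reasoning

module _ (k : ℕ) where
  open Cycle (2 + k)

  private
    C : Graph (5 + k)
    C = cycle (2 + k)

  ¬Succ-cycle₃ : ∀ {a b c} → Succ a b → Succ b c → ¬ Succ c a
  ¬Succ-cycle₃ (up _) (up _) ()
  ¬Succ-cycle₃ (up _) wrap   ()
  ¬Succ-cycle₃ wrap   (up _) ()

  ¬Succ-cycle₄ : ∀ {a b c d} → Succ a b → Succ b c → Succ c d → ¬ Succ d a
  ¬Succ-cycle₄ (up _) (up _) (up _) ()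
  ¬Succ-cycle₄ (up _) (up _) wrap   ()
  ¬Succ-cycle₄ (up _) wrap   (up _) ()
  ¬Succ-cycle₄ wrap   (up _) (up _) ()

  neighbours-at-distance-2 : ∀ {v x y} → Succ (toℕ v) (toℕ x) → Succ (toℕ y) (toℕ v) →
                             IsDist C x y (just 2)
  neighbours-at-distance-2 {v} {x} {y} v→x y→v = step x~v (step v~y here) , shorter
    where
    x~v = adj-sym C {v} {x} (Succ⇒adj v x v→x)
    v~y = adj-sym C {y} {v} (Succ⇒adj y v y→v)
    shorter : ∀ j → j < 2 → ¬ Walk C x y j
    shorter 0 _ here = Succ-asymmetric v→x y→v
    shorter 1 _ (step x~y here) with adj⇒Succ x y x~y
    ... | inj₁ x→y = ¬Succ-cycle₃ v→x x→y y→v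
    ... | inj₂ y→x = Succ-irreflexive (subst (λ a → Succ a (toℕ v)) (Succ-injective y→x v→x) y→v)
    shorter (suc (suc _)) (s≤s (s≤s ()))

  unique-common-neighbour : ∀ {v x y z} → Succ (toℕ v) (toℕ x) → Succ (toℕ y) (toℕ v) →
                            T (adj C x z) → T (adj C z y) → z ≡ v
  unique-common-neighbour {v} {x} {y} {z} v→x y→v x~z z~y with adj⇒Succ x z x~z
  ... | inj₂ z→x = toℕ-injective (Succ-injective z→x v→x)
  ... | inj₁ x→z with adj⇒Succ z y z~y
  ...   | inj₁ z→y = contradiction y→v (¬Succ-cycle₄ v→x x→z z→y)
  ...   | inj₂ y→z = toℕ-injective (Succ-functional y→z y→v (toℕ<n z) (toℕ<n v))

  no-2-walk-avoiding : ∀ {v x y} x₀ y₀ → punchIn v x₀ ≡ x → punchIn v y₀ ≡ y →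
                       Succ (toℕ v) (toℕ x) → Succ (toℕ y) (toℕ v) →
                       ¬ Walk (deleteVertex C v) x₀ y₀ 2
  no-2-walk-avoiding {v} x₀ y₀ refl refl v→x y→v (step {y = z₀} x~z (step z~y here)) =
    punchInᵢ≢i v z₀ (unique-common-neighbour v→x y→v x~z z~y)

  cycle-distanceCritical : DistanceCritical C
  cycle-distanceCritical v with successor v | predecessor v
  ... | x , v→x | y , y→v = x₀ , y₀ , just 2 , d₂ , dist₁ , dist₂ , 2≢d₂ dist₂
    where
    v≢x : v ≢ x
    v≢x refl = Succ-irreflexive v→x
    v≢y : v ≢ y
    v≢y refl = Succ-irreflexive y→v
    x₀ = punchOut v≢x
    y₀ = punchOut v≢y
    dist₁ : IsDist C (punchIn v x₀) (punchIn v y₀) (just 2)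
    dist₁ = subst₂ (λ a b → IsDist C a b (just 2))
      (≡-sym (punchIn-punchOut v≢x)) (≡-sym (punchIn-punchOut v≢y))
      (neighbours-at-distance-2 v→x y→v)
    C-v = deleteVertex C v
    d₂ = proj₁ (dist {G = C-v} x₀ y₀)
    dist₂ = proj₂ (dist {G = C-v} x₀ y₀)
    2≢d₂ : ∀ {d} → IsDist C-v x₀ y₀ d → just 2 ≢ d
    2≢d₂ (w , _) refl =
      no-2-walk-avoiding x₀ y₀ (punchIn-punchOut v≢x) (punchIn-punchOut v≢y) v→x y→v w

lemma5p1 : ((n : ℕ) (G : Graph n) → DistanceCritical G → n ≤ edgeCount G)
    × ((k : ℕ) → DistanceCritical (cycle (2 + k)) × edgeCount (cycle (2 + k)) ≡ 5 + k)
lemma5p1 =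
  (λ _ → distanceCritical⇒n≤edgeCount) ,
  (λ k → cycle-distanceCritical k , Cycle.edgeCount-cycle (2 + k))
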